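{- Let $n\ge3$, $c$ a Coxeter element of $\widehat{\mathfrak S}_n$, and $i,j,k\in\{0,\dots,n\}$ pairwise distinct modulo $n$. Let $a$ be the element of $\{i,j,k\}$ which is neither the maximum nor the minimum. Then $$\omega_c(\beta_{(i,j)},\beta_{(j,k)})=(-1)^{\delta_{a\in\overline{R_c}}+\delta_{k<i}}.$$
   Context: $\widehat{\mathfrak S}_n$: bijections $w$ of $\mathbb Z$ with $w(k+n)=w(k)+n$, $\sum_{k=1}^nw(k)=\sum_{k=1}^nk$, with simple generators $s_i$ ($0\le i\le n-1$) exchanging $i+mn$ and $i+1+mn$ for all $m$. A Coxeter element $c$ is a product of all $s_i$ once each; $\overline{L_c}=\{x\in\mathbb Z:c(x)>x\}$, $\overline{R_c}=\{x:c(x)<x\}$ (these partition $\mathbb Z$). $V$ has basis $\alpha_0,\dots,\alpha_{n-1}$; $\omega_c$ is the skew-symmetric bilinear form with $\omega_c(\alpha_i,\alpha_j)=\pm1$ when $j-i\equiv\pm1\pmod n$, with sign $+$ iff $s_i$ appears before $s_j$ in a reduced word of $c$, and $0$ otherwise. For $0\le a<b\le n$, $\beta_{(a,b)}=\beta_{(b,a)}=\alpha_a+\alpha_{a+1}+\dots+\alpha_{b-1}$. $\delta_P\in\{0,1\}$ is the indicator of $P$. -}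

module Defs where

open import Data.Nat as ℕ using (ℕ; zero; suc; NonZero; _⊔_; _⊓_)
open import Data.Nat.DivMod using (_%_)
import Data.Nat.Properties as ℕP
open import Data.Integer as ℤ using (ℤ; +_; -_; _+_; _*_; _-_; _^_; _%ℕ_)
import Data.Integer.Properties as ℤP
open import Data.Fin using (Fin; zero; suc; toℕ)
import Data.Fin.Properties as FinP
open import Data.Fin.Permutation using (Permutation′; _⟨$⟩ʳ_; _⟨$⟩ˡ_)
open import Data.List using (List; tabulate; foldr)
open import Data.Bool using (Bool; true; false; if_then_else_; _∧_; _∨_)
open import Relation.Nullary.Decidable using (Dec; isYes; ⌊_⌋)
open import Function using (_∘_)

-- Simple reflection s_g of the affine symmetric group, acting on ℤ:
-- it exchanges g + m n and g + 1 + m n for every m.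
sRefl : (n : ℕ) .{{_ : NonZero n}} → Fin n → ℤ → ℤ
sRefl n g x =
  if ⌊ x %ℕ n ℕ.≟ toℕ g ⌋ then x + + 1
  else if ⌊ x %ℕ n ℕ.≟ (toℕ g ℕ.+ 1) % n ⌋ then x - + 1
  else x

-- A Coxeter element is a product s_{w 0} s_{w 1} ... s_{w (n-1)} of all simple
-- generators once each; it is given by the permutation σ with
-- σ ⟨$⟩ʳ p = the generator at position p of the word (and σ ⟨$⟩ˡ g = the
-- position of s_g).  Products are composition of bijections of ℤ:
-- (s_a s_b)(x) = s_a (s_b x).
coxWord : {n : ℕ} → Permutation′ n → List (Fin n)
coxWord σ = tabulate (σ ⟨$⟩ʳ_)

coxeter : (n : ℕ) .{{_ : NonZero n}} → Permutation′ n → ℤ → ℤ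
coxeter n σ x = foldr (sRefl n) x (coxWord σ)

-- V = ℤ-span of α_0, …, α_{n-1}, as coefficient vectors.
V : ℕ → Set
V n = Fin n → ℤ

sumFin : {n : ℕ} → (Fin n → ℤ) → ℤ
sumFin {zero}  f = + 0
sumFin {suc n} f = f zero + sumFin (f ∘ suc)

adjacent : (n : ℕ) .{{_ : NonZero n}} → Fin n → Fin n → Bool
adjacent n i j = ⌊ toℕ j ℕ.≟ (toℕ i ℕ.+ 1) % n ⌋ ∨ ⌊ toℕ i ℕ.≟ (toℕ j ℕ.+ 1) % n ⌋

ωα : (n : ℕ) .{{_ : NonZero n}} → Permutation′ n → Fin n → Fin n → ℤ
ωα n σ i j =
  if adjacent n i j
  then (if ⌊ toℕ (σ ⟨$⟩ˡ i) ℕ.<? toℕ (σ ⟨$⟩ˡ j) ⌋ then + 1 else - (+ 1))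
  else + 0

ω : (n : ℕ) .{{_ : NonZero n}} → Permutation′ n → V n → V n → ℤ
ω n σ u v = sumFin (λ p → sumFin (λ q → u p * v q * ωα n σ p q))

β : (n : ℕ) → ℕ → ℕ → V n
β n a b p = if ⌊ (a ⊓ b) ℕ.≤? toℕ p ⌋ ∧ ⌊ toℕ p ℕ.<? (a ⊔ b) ⌋ then + 1 else + 0

median : ℕ → ℕ → ℕ → ℕ
median i j k = (i ⊓ j) ⊔ ((i ⊔ j) ⊓ k)

δ : {P : Set} → Dec P → ℕ
δ d = if isYes d then 1 else 0

R̄-dec : (n : ℕ) .{{_ : NonZero n}} → (σ : Permutation′ n) → (x : ℤ) → Dec (coxeter n σ x ℤ.< x)
R̄-dec n σ x = coxeter n σ x ℤP.<? x

module Submission where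

-- For x < a < y the vectors β(x,a) and β(a,y) are sums of consecutive simple roots on either
-- side of a, so the only pair of adjacent roots between them is (α_{a-1}, α_a): the wrap-around
-- pair (α_0, α_{n-1}) would force x ≡ y (mod n).  Hence ω_c(β(x,a), β(a,y)) = ω_c(α_{a-1}, α_a),
-- which is +1 iff s_{a-1} precedes s_a in c.  Of these two reflections the one acting first on a
-- moves it away, and as every generator occurs only once in c nothing moves it back; so
-- c(a) > a iff s_{a-1} precedes s_a.  The general case reduces to this one by bilinearity and
-- antisymmetry of ω_c, by β(i,j) = β(i,a) + β(a,j), and by the symmetry i ↔ k.

open import Defs
open import Data.Nat as ℕ using (ℕ; zero; suc; NonZero; _≤_; _<_; _%_; _⊓_; _⊔_; _≤?_; _<?_)
import Data.Nat.Properties as ℕP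
open import Data.Nat.DivMod using (m≡m%n+[m/n]*n; m%n<n; m<n⇒m%n≡m; n%n≡0)
open import Data.Integer as ℤ using (ℤ; +_; -_; -[1+_]; -1ℤ; _+_; _*_; _-_; _^_; _%ℕ_; _/ℕ_; 0ℤ; 1ℤ)
import Data.Integer.Properties as ℤP
open import Data.Integer.DivMod using (a≡a%ℕn+[a/ℕn]*n; n%ℕd<d)
open import Data.Integer.Tactic.RingSolver using (solve-∀)
open import Algebra.Properties.AbelianGroup ℤP.+-0-abelianGroup using (∙-cancelʳ)
open import Algebra.Properties.Semiring.Sum ℤP.+-*-semiring
  using (sum; sum-syntax; sum-cong-≗; ∑-distrib-+; ∑-comm; sum-remove; sum-replicate-zero; *-distribˡ-sum)
open import Data.Fin as Fin using (Fin; zero; suc; toℕ; fromℕ<; punchIn)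
open import Data.Vec.Functional using (removeAt)
import Data.Fin.Properties as FinP
open import Data.Fin.Permutation using (Permutation′; _⟨$⟩ʳ_; _⟨$⟩ˡ_; inverseˡ; inverseʳ; flip)
open import Data.List using (tabulate; foldr)
open import Data.Bool using (if_then_else_; _∧_)
open import Data.Product using (_×_; _,_; proj₁; proj₂; ∃-syntax)
open import Data.Sum using (_⊎_; inj₁; inj₂)
open import Function using (_∘_)
open import Function.Definitions using (Injective)
open import Function.Bundles using (Injection)
open import Function.Properties.Inverse using (Inverse⇒Injection)
open import Relation.Binary.Definitions using (tri<; tri≈; tri>)
open import Relation.Nullary using (¬_; Dec; yes; no)
open import Relation.Nullary.Decidable using (⌊_⌋; _×-dec_)
open import Relation.Nullary.Negation using (contradiction)
open import Relation.Binary.PropositionalEquality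

sumFin≡sum : ∀ {m} (f : Fin m → ℤ) → sumFin f ≡ sum f
sumFin≡sum {zero}  f = refl
sumFin≡sum {suc m} f = cong (_+_ (f zero)) (sumFin≡sum (f ∘ suc))

∑-zero : ∀ {m} {f : Fin m → ℤ} → (∀ i → f i ≡ 0ℤ) → sum f ≡ 0ℤ
∑-zero {m} f≡0 = trans (sum-cong-≗ f≡0) (sum-replicate-zero m)

∑-single : ∀ {m} {f : Fin m → ℤ} i → (∀ j → j ≢ i → f j ≡ 0ℤ) → sum f ≡ f i
∑-single {suc m} {f} i others≡0 = begin
  sum f                     ≡⟨ sum-remove {i = i} f ⟩
  f i + sum (removeAt f i)  ≡⟨ cong (_+_ (f i)) (∑-zero (λ j → others≡0 (punchIn i j) (FinP.punchInᵢ≢i i j))) ⟩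
  f i + 0ℤ                  ≡⟨ ℤP.+-identityʳ (f i) ⟩
  f i                       ∎
  where open ≡-Reasoning

∑-neg : ∀ {m} (f : Fin m → ℤ) → ∑[ i < m ] (- f i) ≡ - sum f
∑-neg {m} f = begin
  ∑[ i < m ] (- f i)    ≡⟨ sum-cong-≗ (λ i → ℤP.-1*i≡-i (f i)) ⟨
  ∑[ i < m ] (-1ℤ * f i) ≡⟨ *-distribˡ-sum -1ℤ f ⟨
  -1ℤ * sum f           ≡⟨ ℤP.-1*i≡-i (sum f) ⟩
  - sum f               ∎
  where open ≡-Reasoning

i≡-i⇒i≡0 : ∀ {i} → i ≡ - i → i ≡ 0ℤ
i≡-i⇒i≡0 {+ zero}   _ = refl
i≡-i⇒i≡0 {+ suc _}  ()
i≡-i⇒i≡0 { -[1+ _ ]} ()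

δ-yes : ∀ {P : Set} (d : Dec P) → P → δ d ≡ 1
δ-yes (yes _) _ = refl
δ-yes (no ¬p) p = contradiction p ¬p

δ-no : ∀ {P : Set} (d : Dec P) → ¬ P → δ d ≡ 0
δ-no (yes p) ¬p = contradiction p ¬p
δ-no (no _)  _  = refl

-1^[m+1]≡-[-1^m] : ∀ m → (- 1ℤ) ^ (m ℕ.+ 1) ≡ - ((- 1ℤ) ^ m)
-1^[m+1]≡-[-1^m] m = trans (cong ((- 1ℤ) ^_) (ℕP.+-comm m 1)) (ℤP.-1*i≡-i ((- 1ℤ) ^ m))

i<i+1 : ∀ i → i ℤ.< i + 1ℤ
i<i+1 i = subst (ℤ._< i + 1ℤ) (ℤP.+-identityʳ i) (ℤP.+-monoʳ-< i (ℤ.+<+ ℕ.z<s))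

i-1<i : ∀ i → i - 1ℤ ℤ.< i
i-1<i i = subst (i - 1ℤ ℤ.<_) (ℤP.+-identityʳ i) (ℤP.+-monoʳ-< i ℤ.-<+)

order-sign-antisym : ∀ {a b} → a ≢ b →
                     (if ⌊ b <? a ⌋ then 1ℤ else - 1ℤ) ≡ - (if ⌊ a <? b ⌋ then 1ℤ else - 1ℤ)
order-sign-antisym {a} {b} a≢b with a <? b | b <? a
... | yes a<b | yes b<a = contradiction b<a (ℕP.<-asym a<b)
... | yes _   | no _    = refl
... | no _    | yes _   = refl
... | no a≮b  | no b≮a  = contradiction (ℕP.≤-antisym (ℕP.≮⇒≥ b≮a) (ℕP.≮⇒≥ a≮b)) a≢b

-- Residues modulo n

module _ {n : ℕ} .{{_ : NonZero n}} where

  +r+qn<+r′+q′n : ∀ {r} r′ {q q′} → r < n → q ℤ.< q′ → + r + q * + n ℤ.< + r′ + q′ * + n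
  +r+qn<+r′+q′n {r} r′ {q} {q′} r<n q<q′ = begin-strict
    + r + q * + n    <⟨ ℤP.+-monoˡ-< (q * + n) (ℤ.+<+ r<n) ⟩
    + n + q * + n    ≡⟨ lemma (+ n) q ⟩
    ℤ.suc q * + n    ≤⟨ ℤP.*-monoʳ-≤-nonNeg (+ n) (ℤP.i<j⇒suc[i]≤j q<q′) ⟩
    q′ * + n         ≤⟨ ℤP.i≤j+i (q′ * + n) (+ r′) ⟩
    + r′ + q′ * + n  ∎
    where
    open ℤP.≤-Reasoning
    lemma : ∀ m q → m + q * m ≡ (1ℤ + q) * m
    lemma = solve-∀

  %ℕ-unique : ∀ {r} q {i} → r < n → i ≡ + r + q * + n → i %ℕ n ≡ r
  %ℕ-unique {r} q {i} r<n i≡r+qn with ℤP.<-cmp q (i /ℕ n)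
  ... | tri< q<q′ _ _ =
    contradiction (trans (sym i≡r+qn) (a≡a%ℕn+[a/ℕn]*n i n)) (ℤP.<⇒≢ (+r+qn<+r′+q′n _ r<n q<q′))
  ... | tri> _ _ q′<q =
    contradiction (trans (sym (a≡a%ℕn+[a/ℕn]*n i n)) i≡r+qn) (ℤP.<⇒≢ (+r+qn<+r′+q′n r (n%ℕd<d i n) q′<q))
  ... | tri≈ _ refl _ =
    ℤP.+-injective (∙-cancelʳ (q * + n) _ _ (trans (sym (a≡a%ℕn+[a/ℕn]*n i n)) i≡r+qn))

  [m+kn]%ℕn≡m%n : ∀ m k → (+ m + k * + n) %ℕ n ≡ m % n
  [m+kn]%ℕn≡m%n m k = %ℕ-unique (+ q + k) (m%n<n m n) (begin
    + m + k * + n                    ≡⟨ cong (λ t → + t + k * + n) (m≡m%n+[m/n]*n m n) ⟩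
    + (m % n ℕ.+ q ℕ.* n) + k * + n  ≡⟨ cong (_+ k * + n) (ℤP.pos-+ (m % n) (q ℕ.* n)) ⟩
    + (m % n) + + (q ℕ.* n) + k * + n ≡⟨ cong (λ t → + (m % n) + t + k * + n) (ℤP.pos-* q n) ⟩
    + (m % n) + + q * + n + k * + n  ≡⟨ lemma (+ (m % n)) (+ q) k (+ n) ⟩
    + (m % n) + (+ q + k) * + n      ∎)
    where
    open ≡-Reasoning
    q = m ℕ./ n
    lemma : ∀ r q k n → r + q * n + k * n ≡ r + (q + k) * n
    lemma = solve-∀

  [i+1]%ℕn≡[i%ℕn+1]%n : ∀ i → (i + 1ℤ) %ℕ n ≡ (i %ℕ n ℕ.+ 1) % n
  [i+1]%ℕn≡[i%ℕn+1]%n i = begin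
    (i + 1ℤ) %ℕ n                    ≡⟨ cong (λ t → (t + 1ℤ) %ℕ n) (a≡a%ℕn+[a/ℕn]*n i n) ⟩
    (+ r + q * + n + 1ℤ) %ℕ n        ≡⟨ cong (_%ℕ n) (lemma (+ r) q (+ n)) ⟩
    (+ r + 1ℤ + q * + n) %ℕ n        ≡⟨ cong (λ t → (t + q * + n) %ℕ n) (ℤP.pos-+ r 1) ⟨
    (+ (r ℕ.+ 1) + q * + n) %ℕ n     ≡⟨ [m+kn]%ℕn≡m%n (r ℕ.+ 1) q ⟩
    (r ℕ.+ 1) % n                    ∎
    where
    open ≡-Reasoning
    r = i %ℕ n
    q = i /ℕ n
    lemma : ∀ r q n → r + q * n + 1ℤ ≡ r + 1ℤ + q * n
    lemma = solve-∀

  [m+1]%n-cases : ∀ {m} → m < n → (m ℕ.+ 1) % n ≡ m ℕ.+ 1 ⊎ (m ℕ.+ 1 ≡ n × (m ℕ.+ 1) % n ≡ 0)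
  [m+1]%n-cases {m} m<n with ℕP.m≤n⇒m<n∨m≡n (subst (_≤ n) (ℕP.+-comm 1 m) m<n)
  ... | inj₁ m+1<n = inj₁ (m<n⇒m%n≡m m+1<n)
  ... | inj₂ m+1≡n = inj₂ (m+1≡n , trans (cong (_% n) m+1≡n) (n%n≡0 n))

  [m+1]%n-injective : ∀ {a b} → a < n → b < n → (a ℕ.+ 1) % n ≡ (b ℕ.+ 1) % n → a ≡ b
  [m+1]%n-injective {a} {b} a<n b<n e with [m+1]%n-cases a<n | [m+1]%n-cases b<n
  ... | inj₁ ea | inj₁ eb = ℕP.+-cancelʳ-≡ 1 a b (trans (sym ea) (trans e eb))
  ... | inj₁ ea | inj₂ (_ , eb) = contradiction (trans (sym ea) (trans e eb)) (ℕP.m+1+n≢0 a)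
  ... | inj₂ (_ , ea) | inj₁ eb = contradiction (trans (sym eb) (trans (sym e) ea)) (ℕP.m+1+n≢0 b)
  ... | inj₂ (a+1≡n , _) | inj₂ (b+1≡n , _) = ℕP.+-cancelʳ-≡ 1 a b (trans a+1≡n (sym b+1≡n))

  [m+1]%n≢m : 2 ≤ n → ∀ {m} → m < n → (m ℕ.+ 1) % n ≢ m
  [m+1]%n≢m 2≤n {m} m<n e with [m+1]%n-cases m<n
  ... | inj₁ e′ = ℕP.m+1+n≢m m (trans (sym e′) e)
  ... | inj₂ (m+1≡n , e′) = ℕP.<⇒≱ 2≤n (ℕP.≤-reflexive n≡1)
    where
    n≡1 : n ≡ 1
    n≡1 = trans (sym m+1≡n) (cong (ℕ._+ 1) (trans (sym e) e′))

  successor-differs : 2 ≤ n → ∀ {g h : Fin n} → toℕ h ≡ (toℕ g ℕ.+ 1) % n → g ≢ h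
  successor-differs 2≤n {g} e refl = [m+1]%n≢m 2≤n (FinP.toℕ<n g) (sym e)

  step-across-cut : ∀ {P Q a} → P < a → a ≤ Q → Q < n → Q ≡ (P ℕ.+ 1) % n → suc P ≡ a × Q ≡ a
  step-across-cut {P} {Q} {a} P<a a≤Q Q<n e
    with [m+1]%n-cases (ℕP.<-≤-trans P<a (ℕP.≤-trans a≤Q (ℕP.<⇒≤ Q<n)))
  ... | inj₁ e′ = 1+P≡a , trans Q≡1+P 1+P≡a
    where
    Q≡1+P = trans e (trans e′ (ℕP.+-comm P 1))
    1+P≡a = ℕP.≤-antisym P<a (subst (a ≤_) Q≡1+P a≤Q)
  ... | inj₂ (_ , e′) = contradiction (ℕP.≤-trans P<a (subst (a ≤_) (trans e e′) a≤Q)) λ ()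

  wrap-across-cut : ∀ {P Q a} → P < a → a ≤ Q → Q < n → P ≡ (Q ℕ.+ 1) % n → P ≡ 0 × Q ℕ.+ 1 ≡ n
  wrap-across-cut {P} {Q} P<a a≤Q Q<n e with [m+1]%n-cases Q<n
  ... | inj₁ e′ = contradiction (ℕP.<-≤-trans P<a a≤Q) (ℕP.<⇒≯ Q<P)
    where
    Q<P : Q < P
    Q<P = subst (Q <_) (sym (trans e (trans e′ (ℕP.+-comm Q 1)))) (ℕP.n<1+n Q)
  ... | inj₂ (Q+1≡n , e′) = trans e e′ , Q+1≡n

-- Intervals and medians

indicator : ℕ → ℕ → ℕ → ℤ
indicator x y m = if ⌊ x ≤? m ⌋ ∧ ⌊ m <? y ⌋ then 1ℤ else 0ℤ

indicator-inside : ∀ {x y m} → x ≤ m → m < y → indicator x y m ≡ 1ℤ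
indicator-inside {x} {y} {m} x≤m m<y with x ≤? m | m <? y
... | yes _   | yes _  = refl
... | no x≰m  | _      = contradiction x≤m x≰m
... | yes _   | no m≮y = contradiction m<y m≮y

indicator-outside : ∀ {x y m} → ¬ (x ≤ m × m < y) → indicator x y m ≡ 0ℤ
indicator-outside {x} {y} {m} m∉ with x ≤? m | m <? y
... | yes x≤m | yes m<y = contradiction (x≤m , m<y) m∉
... | yes _   | no _    = refl
... | no _    | _       = refl

indicator-split : ∀ {x a y} → x ≤ a → a ≤ y → ∀ m → indicator x y m ≡ indicator x a m + indicator a y m
indicator-split {x} {a} {y} x≤a a≤y m with x ≤? m | m <? a | a ≤? m | m <? y
... | no x≰m | _       | yes a≤m | _      = contradiction (ℕP.≤-trans x≤a a≤m) x≰m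
... | no _   | _       | no _    | _      = refl
... | yes _  | yes m<a | yes a≤m | _      = contradiction a≤m (ℕP.<⇒≱ m<a)
... | yes _  | yes _   | no _    | yes _  = refl
... | yes _  | yes m<a | no _    | no m≮y = contradiction (ℕP.<-≤-trans m<a a≤y) m≮y
... | yes _  | no _    | yes _   | yes _  = refl
... | yes _  | no _    | yes _   | no _   = refl
... | yes _  | no m≮a  | no a≰m  | _      = contradiction (ℕP.≮⇒≥ m≮a) a≰m

median-middle : ∀ {i j k} → i ≤ j → j ≤ k → median i j k ≡ j
median-middle {i} {j} {k} i≤j j≤k
  rewrite ℕP.m≤n⇒m⊓n≡m i≤j | ℕP.m≤n⇒m⊔n≡n i≤j | ℕP.m≤n⇒m⊓n≡m j≤k = ℕP.m≤n⇒m⊔n≡n i≤j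

median-right : ∀ {i j k} → i ≤ k → k ≤ j → median i j k ≡ k
median-right {i} {j} {k} i≤k k≤j
  rewrite ℕP.m≤n⇒m⊓n≡m (ℕP.≤-trans i≤k k≤j) | ℕP.m≤n⇒m⊔n≡n (ℕP.≤-trans i≤k k≤j) | ℕP.m≥n⇒m⊓n≡n k≤j =
  ℕP.m≤n⇒m⊔n≡n i≤k

median-left : ∀ {i j k} → j ≤ i → i ≤ k → median i j k ≡ i
median-left {i} {j} {k} j≤i i≤k
  rewrite ℕP.m≥n⇒m⊓n≡n j≤i | ℕP.m≥n⇒m⊔n≡m j≤i | ℕP.m≤n⇒m⊓n≡m i≤k = ℕP.m≤n⇒m⊔n≡n j≤i

median-comm : ∀ i j k → median i j k ≡ median k j i
median-comm i j k = begin
  (i ⊓ j) ⊔ ((i ⊔ j) ⊓ k)          ≡⟨ cong ((i ⊓ j) ⊔_) (ℕP.⊓-distribʳ-⊔ k i j) ⟩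
  (i ⊓ j) ⊔ ((i ⊓ k) ⊔ (j ⊓ k))    ≡⟨ ℕP.⊔-comm (i ⊓ j) _ ⟩
  ((i ⊓ k) ⊔ (j ⊓ k)) ⊔ (i ⊓ j)    ≡⟨ cong₂ (λ s t → s ⊔ t ⊔ (i ⊓ j)) (ℕP.⊓-comm i k) (ℕP.⊓-comm j k) ⟩
  ((k ⊓ i) ⊔ (k ⊓ j)) ⊔ (i ⊓ j)    ≡⟨ cong (_⊔ (i ⊓ j)) (ℕP.⊔-comm (k ⊓ i) (k ⊓ j)) ⟩
  ((k ⊓ j) ⊔ (k ⊓ i)) ⊔ (i ⊓ j)    ≡⟨ ℕP.⊔-assoc (k ⊓ j) (k ⊓ i) (i ⊓ j) ⟩
  (k ⊓ j) ⊔ ((k ⊓ i) ⊔ (i ⊓ j))    ≡⟨ cong (λ t → (k ⊓ j) ⊔ ((k ⊓ i) ⊔ t)) (ℕP.⊓-comm i j) ⟩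
  (k ⊓ j) ⊔ ((k ⊓ i) ⊔ (j ⊓ i))    ≡⟨ cong ((k ⊓ j) ⊔_) (ℕP.⊓-distribʳ-⊔ i k j) ⟨
  (k ⊓ j) ⊔ ((k ⊔ j) ⊓ i)          ∎
  where open ≡-Reasoning

module _ {n : ℕ} where

  β-ordered : ∀ {x y} → x ≤ y → ∀ p → β n x y p ≡ indicator x y (toℕ p)
  β-ordered x≤y p = cong₂ (λ s t → indicator s t (toℕ p)) (ℕP.m≤n⇒m⊓n≡m x≤y) (ℕP.m≤n⇒m⊔n≡n x≤y)

  β-comm : ∀ x y p → β n x y p ≡ β n y x p
  β-comm x y p = cong₂ (λ s t → indicator s t (toℕ p)) (ℕP.⊓-comm x y) (ℕP.⊔-comm x y)

  β-inside : ∀ {x y p} → x ≤ toℕ p → toℕ p < y → β n x y p ≡ 1ℤ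
  β-inside {x} {y} {p} x≤p p<y =
    trans (β-ordered {x} {y} (ℕP.≤-trans x≤p (ℕP.<⇒≤ p<y)) p) (indicator-inside x≤p p<y)

  β-outside : ∀ {x y p} → x ≤ y → ¬ (x ≤ toℕ p × toℕ p < y) → β n x y p ≡ 0ℤ
  β-outside {x} {y} {p} x≤y p∉ = trans (β-ordered {x} {y} x≤y p) (indicator-outside p∉)

  β-split : ∀ {x a y} → x ≤ a → a ≤ y → ∀ p → β n x y p ≡ β n x a p + β n a y p
  β-split {x} {a} {y} x≤a a≤y p = begin
    β n x y p                                    ≡⟨ β-ordered (ℕP.≤-trans x≤a a≤y) p ⟩
    indicator x y (toℕ p)                        ≡⟨ indicator-split x≤a a≤y (toℕ p) ⟩
    indicator x a (toℕ p) + indicator a y (toℕ p) ≡⟨ cong₂ _+_ (β-ordered x≤a p) (β-ordered a≤y p) ⟨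
    β n x a p + β n a y p                        ∎
    where open ≡-Reasoning

-- Simple reflections acting on ℤ

module _ {n : ℕ} .{{_ : NonZero n}} where

  Raises : Fin n → ℤ → Set
  Raises g y = y %ℕ n ≡ toℕ g

  Lowers : Fin n → ℤ → Set
  Lowers g y = y %ℕ n ≡ (toℕ g ℕ.+ 1) % n

  sRefl-raise : ∀ {g y} → Raises g y → sRefl n g y ≡ y + 1ℤ
  sRefl-raise {g} {y} r with y %ℕ n ℕ.≟ toℕ g
  ... | yes _ = refl
  ... | no ¬r = contradiction r ¬r

  sRefl-lower : ∀ {g y} → ¬ Raises g y → Lowers g y → sRefl n g y ≡ y - 1ℤ
  sRefl-lower {g} {y} ¬r l with y %ℕ n ℕ.≟ toℕ g | y %ℕ n ℕ.≟ (toℕ g ℕ.+ 1) % n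
  ... | yes r | _    = contradiction r ¬r
  ... | no _  | yes _ = refl
  ... | no _  | no ¬l = contradiction l ¬l

  sRefl-fix : ∀ {g y} → ¬ Raises g y → ¬ Lowers g y → sRefl n g y ≡ y
  sRefl-fix {g} {y} ¬r ¬l with y %ℕ n ℕ.≟ toℕ g | y %ℕ n ℕ.≟ (toℕ g ℕ.+ 1) % n
  ... | yes r | _    = contradiction r ¬r
  ... | no _  | yes l = contradiction l ¬l
  ... | no _  | no _  = refl

  raises-injective : ∀ {g h y} → Raises g y → Raises h y → g ≡ h
  raises-injective r r′ = FinP.toℕ-injective (trans (sym r) r′)

  lowers-injective : ∀ {g h y} → Lowers g y → Lowers h y → g ≡ h
  lowers-injective {g} {h} l l′ =
    FinP.toℕ-injective ([m+1]%n-injective (FinP.toℕ<n g) (FinP.toℕ<n h) (trans (sym l) l′))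

  raises⇒¬lowers : 2 ≤ n → ∀ {g y} → Raises g y → ¬ Lowers g y
  raises⇒¬lowers 2≤n {g} r l = [m+1]%n≢m 2≤n (FinP.toℕ<n g) (trans (sym l) r)

  raise-lowers : ∀ {g y} → Raises g y → Lowers g (y + 1ℤ)
  raise-lowers {g} {y} r = trans ([i+1]%ℕn≡[i%ℕn+1]%n y) (cong (λ t → (t ℕ.+ 1) % n) r)

  lower-raises : ∀ {g y} → Lowers g y → Raises g (y - 1ℤ)
  lower-raises {g} {y} l = [m+1]%n-injective (n%ℕd<d (y - 1ℤ) n) (FinP.toℕ<n g) (begin
    ((y - 1ℤ) %ℕ n ℕ.+ 1) % n  ≡⟨ [i+1]%ℕn≡[i%ℕn+1]%n (y - 1ℤ) ⟨
    (y - 1ℤ + 1ℤ) %ℕ n         ≡⟨ cong (_%ℕ n) (lemma y) ⟩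
    y %ℕ n                     ≡⟨ l ⟩
    (toℕ g ℕ.+ 1) % n          ∎)
    where
    open ≡-Reasoning
    lemma : ∀ y → y - 1ℤ + 1ℤ ≡ y
    lemma = solve-∀

  foldr-sRefl-fixed : ∀ {m} (f : Fin m → Fin n) {x} → (∀ q → sRefl n (f q) x ≡ x) →
                      foldr (sRefl n) x (tabulate f) ≡ x
  foldr-sRefl-fixed {zero}  f fixed = refl
  foldr-sRefl-fixed {suc m} f fixed =
    trans (cong (sRefl n (f zero)) (foldr-sRefl-fixed (f ∘ suc) (fixed ∘ suc))) (fixed zero)

  module _ (x : ℤ) where

    -- y has risen above x, and the generator that would bring it back down has already been used.
    Above : ∀ {m} → (Fin m → Fin n) → ℤ → Set
    Above f y = x ℤ.< y × ∃[ q ] Lowers (f q) y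

    Below : ∀ {m} → (Fin m → Fin n) → ℤ → Set
    Below f y = y ℤ.< x × ∃[ q ] Raises (f q) y

    above-step : ∀ {m} {f : Fin (suc m) → Fin n} {y} → Injective _≡_ _≡_ f →
                 Above (f ∘ suc) y → Above f (sRefl n (f zero) y)
    above-step {f = f} {y} f-inj (x<y , q , l)
      with y %ℕ n ℕ.≟ toℕ (f zero) | y %ℕ n ℕ.≟ (toℕ (f zero) ℕ.+ 1) % n
    ... | yes r | _      = ℤP.<-trans x<y (i<i+1 y) , zero , raise-lowers {y = y} r
    ... | no _  | yes l′ = contradiction (f-inj (lowers-injective {y = y} l′ l)) λ ()
    ... | no _  | no _   = x<y , suc q , l

    below-step : ∀ {m} {f : Fin (suc m) → Fin n} {y} → Injective _≡_ _≡_ f →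
                 Below (f ∘ suc) y → Below f (sRefl n (f zero) y)
    below-step {f = f} {y} f-inj (y<x , q , r)
      with y %ℕ n ℕ.≟ toℕ (f zero) | y %ℕ n ℕ.≟ (toℕ (f zero) ℕ.+ 1) % n
    ... | yes r′ | _    = contradiction (f-inj (raises-injective {y = y} r′ r)) λ ()
    ... | no _   | yes l = ℤP.<-trans (i-1<i y) y<x , zero , lower-raises {y = y} l
    ... | no _   | no _  = y<x , suc q , r

    above-from : ∀ {m} {f : Fin m → Fin n} → Injective _≡_ _≡_ f → ∀ p → Raises (f p) x →
                 (∀ q → p Fin.< q → ¬ Lowers (f q) x) → Above f (foldr (sRefl n) x (tabulate f))
    above-from {f = f} f-inj zero r ¬lowers =
      subst (Above f) (sym word-raises) (i<i+1 x , zero , raise-lowers {y = x} r)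
      where
      rest-fixes : foldr (sRefl n) x (tabulate (f ∘ suc)) ≡ x
      rest-fixes = foldr-sRefl-fixed (f ∘ suc) λ q →
        sRefl-fix (λ r′ → contradiction (f-inj (raises-injective {y = x} r′ r)) λ ()) (¬lowers (suc q) ℕ.z<s)
      word-raises : foldr (sRefl n) x (tabulate f) ≡ x + 1ℤ
      word-raises = trans (cong (sRefl n (f zero)) rest-fixes) (sRefl-raise {y = x} r)
    above-from f-inj (suc p) r ¬lowers =
      above-step f-inj (above-from (FinP.suc-injective ∘ f-inj) p r (λ q p<q → ¬lowers (suc q) (ℕ.s<s p<q)))

    -- sRefl tests Raises before Lowers, so unlike in above-from position p itself must not raise x.
    below-from : ∀ {m} {f : Fin m → Fin n} → Injective _≡_ _≡_ f → ∀ p → Lowers (f p) x →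
                 (∀ q → p Fin.≤ q → ¬ Raises (f q) x) → Below f (foldr (sRefl n) x (tabulate f))
    below-from {f = f} f-inj zero l ¬raises =
      subst (Below f) (sym word-lowers) (i-1<i x , zero , lower-raises {y = x} l)
      where
      rest-fixes : foldr (sRefl n) x (tabulate (f ∘ suc)) ≡ x
      rest-fixes = foldr-sRefl-fixed (f ∘ suc) λ q →
        sRefl-fix (¬raises (suc q) ℕ.z≤n) (λ l′ → contradiction (f-inj (lowers-injective {y = x} l′ l)) λ ())
      word-lowers : foldr (sRefl n) x (tabulate f) ≡ x - 1ℤ
      word-lowers = trans (cong (sRefl n (f zero)) rest-fixes) (sRefl-lower {y = x} (¬raises zero ℕ.z≤n) l)
    below-from f-inj (suc p) l ¬raises =
      below-step f-inj (below-from (FinP.suc-injective ∘ f-inj) p l (λ q p≤q → ¬raises (suc q) (ℕ.s≤s p≤q)))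

-- The Coxeter element and the form ω_c

module _ {n : ℕ} .{{_ : NonZero n}} (σ : Permutation′ n) where

  ⟨$⟩ʳ-injective : Injective _≡_ _≡_ (σ ⟨$⟩ʳ_)
  ⟨$⟩ʳ-injective = Injection.injective (Inverse⇒Injection σ)

  ⟨$⟩ˡ-injective : Injective _≡_ _≡_ (σ ⟨$⟩ˡ_)
  ⟨$⟩ˡ-injective = Injection.injective (Inverse⇒Injection (flip σ))

  position-injective : ∀ {g h} → toℕ (σ ⟨$⟩ˡ g) ≡ toℕ (σ ⟨$⟩ˡ h) → g ≡ h
  position-injective = ⟨$⟩ˡ-injective ∘ FinP.toℕ-injective

  coxeter-raises : ∀ {A B x} → Raises A x → Lowers B x → σ ⟨$⟩ˡ B Fin.< σ ⟨$⟩ˡ A → x ℤ.< coxeter n σ x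
  coxeter-raises {A} {B} {x} r l B<A =
    proj₁ (above-from x ⟨$⟩ʳ-injective (σ ⟨$⟩ˡ A) (subst (λ g → Raises g x) (sym (inverseʳ σ)) r) ¬lowers)
    where
    ¬lowers : ∀ q → σ ⟨$⟩ˡ A Fin.< q → ¬ Lowers (σ ⟨$⟩ʳ q) x
    ¬lowers q A<q l′ = ℕP.<-asym B<A (subst (σ ⟨$⟩ˡ A Fin.<_) q≡B A<q)
      where
      q≡B : q ≡ σ ⟨$⟩ˡ B
      q≡B = trans (sym (inverseˡ σ)) (cong (σ ⟨$⟩ˡ_) (lowers-injective {y = x} l′ l))

  coxeter-lowers : ∀ {A B x} → Raises A x → Lowers B x → σ ⟨$⟩ˡ A Fin.< σ ⟨$⟩ˡ B → coxeter n σ x ℤ.< x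
  coxeter-lowers {A} {B} {x} r l A<B =
    proj₁ (below-from x ⟨$⟩ʳ-injective (σ ⟨$⟩ˡ B) (subst (λ g → Lowers g x) (sym (inverseʳ σ)) l) ¬raises)
    where
    ¬raises : ∀ q → σ ⟨$⟩ˡ B Fin.≤ q → ¬ Raises (σ ⟨$⟩ʳ q) x
    ¬raises q B≤q r′ = ℕP.<⇒≱ A<B (subst (σ ⟨$⟩ˡ B Fin.≤_) q≡A B≤q)
      where
      q≡A : q ≡ σ ⟨$⟩ˡ A
      q≡A = trans (sym (inverseˡ σ)) (cong (σ ⟨$⟩ˡ_) (raises-injective {y = x} r′ r))

  ωα-sign : 2 ≤ n → ∀ {A B x} → Raises A x → Lowers B x → ωα n σ B A ≡ (- 1ℤ) ^ δ (R̄-dec n σ x)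
  ωα-sign 2≤n {A} {B} {x} r l with toℕ A ℕ.≟ (toℕ B ℕ.+ 1) % n
  ... | no ¬adj = contradiction (trans (sym r) l) ¬adj
  ... | yes _ with toℕ (σ ⟨$⟩ˡ B) <? toℕ (σ ⟨$⟩ˡ A) | R̄-dec n σ x
  ...   | yes B<A | yes cx<x = contradiction (coxeter-raises r l B<A) (ℤP.<-asym cx<x)
  ...   | yes _   | no _     = refl
  ...   | no _    | yes _    = refl
  ...   | no B≮A  | no cx≮x  = contradiction (coxeter-lowers r l A<B) cx≮x
    where
    A≢B : A ≢ B
    A≢B refl = raises⇒¬lowers 2≤n {y = x} r l
    A<B : σ ⟨$⟩ˡ A Fin.< σ ⟨$⟩ˡ B
    A<B = ℕP.≤∧≢⇒< (ℕP.≮⇒≥ B≮A) (A≢B ∘ position-injective)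

  Ω : V n → V n → Fin n → Fin n → ℤ
  Ω u v p q = u p * v q * ωα n σ p q

  ω≡∑∑ : ∀ u v → ω n σ u v ≡ ∑[ p < n ] ∑[ q < n ] Ω u v p q
  ω≡∑∑ u v = trans (sumFin≡sum (λ p → sumFin (Ω u v p))) (sum-cong-≗ (λ p → sumFin≡sum (Ω u v p)))

  ω-cong : ∀ {u u′ v v′} → (∀ p → u p ≡ u′ p) → (∀ q → v q ≡ v′ q) → ω n σ u v ≡ ω n σ u′ v′
  ω-cong {u} {u′} {v} {v′} u≗u′ v≗v′ = begin
    ω n σ u v                          ≡⟨ ω≡∑∑ u v ⟩
    ∑[ p < n ] ∑[ q < n ] Ω u v p q    ≡⟨ sum-cong-≗ (λ p → sum-cong-≗ (λ q →
                                            cong₂ (λ s t → s * t * ωα n σ p q) (u≗u′ p) (v≗v′ q))) ⟩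
    ∑[ p < n ] ∑[ q < n ] Ω u′ v′ p q  ≡⟨ ω≡∑∑ u′ v′ ⟨
    ω n σ u′ v′                        ∎
    where open ≡-Reasoning

  ω-congˡ : ∀ {u u′} v → (∀ p → u p ≡ u′ p) → ω n σ u v ≡ ω n σ u′ v
  ω-congˡ {u} {u′} v u≗u′ = ω-cong {u} {u′} {v} {v} u≗u′ (λ _ → refl)

  ω-congʳ : ∀ u {v v′} → (∀ q → v q ≡ v′ q) → ω n σ u v ≡ ω n σ u v′
  ω-congʳ u {v} {v′} = ω-cong {u} {u} {v} {v′} (λ _ → refl)

  ω-additive : ∀ {u v u₁ v₁ u₂ v₂} → (∀ p q → Ω u v p q ≡ Ω u₁ v₁ p q + Ω u₂ v₂ p q) →
               ω n σ u v ≡ ω n σ u₁ v₁ + ω n σ u₂ v₂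
  ω-additive {u} {v} {u₁} {v₁} {u₂} {v₂} split = begin
    ω n σ u v
      ≡⟨ ω≡∑∑ u v ⟩
    ∑[ p < n ] ∑[ q < n ] Ω u v p q
      ≡⟨ sum-cong-≗ (λ p → trans (sum-cong-≗ (split p)) (∑-distrib-+ (Ω u₁ v₁ p) (Ω u₂ v₂ p))) ⟩
    ∑[ p < n ] (∑[ q < n ] Ω u₁ v₁ p q + ∑[ q < n ] Ω u₂ v₂ p q)
      ≡⟨ ∑-distrib-+ (λ p → ∑[ q < n ] Ω u₁ v₁ p q) (λ p → ∑[ q < n ] Ω u₂ v₂ p q) ⟩
    ∑[ p < n ] ∑[ q < n ] Ω u₁ v₁ p q + ∑[ p < n ] ∑[ q < n ] Ω u₂ v₂ p q
      ≡⟨ cong₂ _+_ (ω≡∑∑ u₁ v₁) (ω≡∑∑ u₂ v₂) ⟨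
    ω n σ u₁ v₁ + ω n σ u₂ v₂
      ∎
    where open ≡-Reasoning

  ω-linearˡ : ∀ {u u₁ u₂ v} → (∀ p → u p ≡ u₁ p + u₂ p) → ω n σ u v ≡ ω n σ u₁ v + ω n σ u₂ v
  ω-linearˡ {u} {u₁} {u₂} {v} u≡u₁+u₂ = ω-additive {u} {v} {u₁} {v} {u₂} {v} λ p q →
    trans (cong (λ t → t * v q * ωα n σ p q) (u≡u₁+u₂ p)) (lemma (u₁ p) (u₂ p) (v q) (ωα n σ p q))
    where
    lemma : ∀ a b c w → (a + b) * c * w ≡ a * c * w + b * c * w
    lemma = solve-∀

  ω-linearʳ : ∀ {u v v₁ v₂} → (∀ q → v q ≡ v₁ q + v₂ q) → ω n σ u v ≡ ω n σ u v₁ + ω n σ u v₂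
  ω-linearʳ {u} {v} {v₁} {v₂} v≡v₁+v₂ = ω-additive {u} {v} {u} {v₁} {u} {v₂} λ p q →
    trans (cong (λ t → u p * t * ωα n σ p q) (v≡v₁+v₂ q)) (lemma (u p) (v₁ q) (v₂ q) (ωα n σ p q))
    where
    lemma : ∀ a b c w → a * (b + c) * w ≡ a * b * w + a * c * w
    lemma = solve-∀

  ωα-nonadjacent : ∀ {p q} → toℕ q ≢ (toℕ p ℕ.+ 1) % n → toℕ p ≢ (toℕ q ℕ.+ 1) % n → ωα n σ p q ≡ 0ℤ
  ωα-nonadjacent {p} {q} q≢p+1 p≢q+1 with toℕ q ℕ.≟ (toℕ p ℕ.+ 1) % n | toℕ p ℕ.≟ (toℕ q ℕ.+ 1) % n
  ... | yes e | _     = contradiction e q≢p+1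
  ... | no _  | yes e = contradiction e p≢q+1
  ... | no _  | no _  = refl

  ωα-antisym : 2 ≤ n → ∀ p q → ωα n σ q p ≡ - ωα n σ p q
  ωα-antisym 2≤n p q with toℕ q ℕ.≟ (toℕ p ℕ.+ 1) % n | toℕ p ℕ.≟ (toℕ q ℕ.+ 1) % n
  ... | no _  | no _  = refl
  ... | yes e | yes _ = order-sign-antisym (successor-differs 2≤n e ∘ position-injective)
  ... | yes e | no _  = order-sign-antisym (successor-differs 2≤n e ∘ position-injective)
  ... | no _  | yes e = order-sign-antisym (successor-differs 2≤n e ∘ sym ∘ position-injective)

  ω-antisym : 2 ≤ n → ∀ u v → ω n σ v u ≡ - ω n σ u v
  ω-antisym 2≤n u v = begin
    ω n σ v u                             ≡⟨ ω≡∑∑ v u ⟩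
    ∑[ p < n ] ∑[ q < n ] Ω v u p q       ≡⟨ ∑-comm (Ω v u) ⟩
    ∑[ q < n ] ∑[ p < n ] Ω v u p q       ≡⟨ sum-cong-≗ (λ q → sum-cong-≗ (λ p → Ω-swap q p)) ⟩
    ∑[ q < n ] ∑[ p < n ] (- Ω u v q p)   ≡⟨ sum-cong-≗ (λ q → ∑-neg (Ω u v q)) ⟩
    ∑[ q < n ] (- ∑[ p < n ] Ω u v q p)   ≡⟨ ∑-neg (λ q → ∑[ p < n ] Ω u v q p) ⟩
    - ∑[ q < n ] ∑[ p < n ] Ω u v q p     ≡⟨ cong -_ (ω≡∑∑ u v) ⟨
    - ω n σ u v                           ∎
    where
    open ≡-Reasoning
    lemma : ∀ a b w → b * a * - w ≡ - (a * b * w)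
    lemma = solve-∀
    Ω-swap : ∀ q p → Ω v u p q ≡ - Ω u v q p
    Ω-swap q p = trans (cong (v p * u q *_) (ωα-antisym 2≤n q p)) (lemma (u q) (v p) (ωα n σ q p))

  ω-self : 2 ≤ n → ∀ u → ω n σ u u ≡ 0ℤ
  ω-self 2≤n u = i≡-i⇒i≡0 (ω-antisym 2≤n u u)

  ε : ℕ → ℤ
  ε a = (- 1ℤ) ^ δ (R̄-dec n σ (+ a))

  Ω-β-β-vanishes : ∀ {x a y} → x < a → a < y → y ≤ n → x % n ≢ y % n → ∀ p q →
                   ¬ (suc (toℕ p) ≡ a × toℕ q ≡ a) → Ω (β n x a) (β n a y) p q ≡ 0ℤ
  Ω-β-β-vanishes {x} {a} {y} x<a a<y y≤n x≢y p q off-cut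
    with (x ≤? toℕ p) ×-dec (toℕ p <? a) | (a ≤? toℕ q) ×-dec (toℕ q <? y)
  ... | no p∉ | _ = cong (λ t → t * β n a y q * ωα n σ p q) (β-outside (ℕP.<⇒≤ x<a) p∉)
  ... | yes _ | no q∉ = begin
    β n x a p * β n a y q * ωα n σ p q  ≡⟨ cong (λ t → β n x a p * t * ωα n σ p q) (β-outside (ℕP.<⇒≤ a<y) q∉) ⟩
    β n x a p * 0ℤ * ωα n σ p q         ≡⟨ cong (_* ωα n σ p q) (ℤP.*-zeroʳ (β n x a p)) ⟩
    0ℤ                                  ∎
    where open ≡-Reasoning
  ... | yes (x≤p , p<a) | yes (a≤q , q<y) = begin
    β n x a p * β n a y q * ωα n σ p q  ≡⟨ cong (β n x a p * β n a y q *_) (ωα-nonadjacent no-step no-wrap) ⟩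
    β n x a p * β n a y q * 0ℤ          ≡⟨ ℤP.*-zeroʳ (β n x a p * β n a y q) ⟩
    0ℤ                                  ∎
    where
    open ≡-Reasoning
    no-step : toℕ q ≢ (toℕ p ℕ.+ 1) % n
    no-step = off-cut ∘ step-across-cut p<a a≤q (FinP.toℕ<n q)
    no-wrap : toℕ p ≢ (toℕ q ℕ.+ 1) % n
    no-wrap e with wrap-across-cut p<a a≤q (FinP.toℕ<n q) e
    ... | p≡0 , q+1≡n = x≢y (begin
      x % n  ≡⟨ cong (_% n) (ℕP.n≤0⇒n≡0 (subst (x ≤_) p≡0 x≤p)) ⟩
      0 % n  ≡⟨ m<n⇒m%n≡m (ℕ.>-nonZero⁻¹ n) ⟩
      0      ≡⟨ n%n≡0 n ⟨
      n % n  ≡⟨ cong (_% n) (ℕP.≤-antisym n≤y y≤n) ⟩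
      y % n  ∎)
      where
      n≤y : n ≤ y
      n≤y = subst (_≤ y) q+1≡n (subst (_≤ y) (ℕP.+-comm 1 (toℕ q)) q<y)

  ω-β-β-consecutive : 2 ≤ n → ∀ {x a y} → x < a → a < y → y ≤ n → x % n ≢ y % n →
                      ω n σ (β n x a) (β n a y) ≡ ε a
  ω-β-β-consecutive 2≤n {x} {suc b} {y} x<a a<y y≤n x≢y = begin
    ω n σ (β n x a) (β n a y)                        ≡⟨ ω≡∑∑ (β n x a) (β n a y) ⟩
    ∑[ p < n ] ∑[ q < n ] Ω (β n x a) (β n a y) p q  ≡⟨ ∑-single B (λ p p≢B → ∑-zero (λ q →
                                                          vanishes p q (p≢B ∘ at-B ∘ proj₁))) ⟩
    ∑[ q < n ] Ω (β n x a) (β n a y) B q             ≡⟨ ∑-single A (λ q q≢A → vanishes B q (q≢A ∘ at-A ∘ proj₂)) ⟩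
    β n x a B * β n a y A * ωα n σ B A               ≡⟨ cong₂ (λ s t → s * t * ωα n σ B A)
                                                          (β-inside x≤B B<a) (β-inside a≤A A<y) ⟩
    1ℤ * 1ℤ * ωα n σ B A                             ≡⟨ ℤP.*-identityˡ (ωα n σ B A) ⟩
    ωα n σ B A                                       ≡⟨ ωα-sign 2≤n {x = + a} raises lowers ⟩
    ε a                                              ∎
    where
    open ≡-Reasoning
    a = suc b
    a<n : a < n
    a<n = ℕP.<-≤-trans a<y y≤n
    A B : Fin n
    A = fromℕ< a<n
    B = fromℕ< (ℕP.<⇒≤ a<n)
    toℕA : toℕ A ≡ a
    toℕA = FinP.toℕ-fromℕ< a<n
    toℕB : toℕ B ≡ b
    toℕB = FinP.toℕ-fromℕ< (ℕP.<⇒≤ a<n)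
    at-A : ∀ {q} → toℕ q ≡ a → q ≡ A
    at-A q≡a = FinP.toℕ-injective (trans q≡a (sym toℕA))
    at-B : ∀ {p} → suc (toℕ p) ≡ a → p ≡ B
    at-B 1+p≡a = FinP.toℕ-injective (trans (ℕP.suc-injective 1+p≡a) (sym toℕB))
    x≤B : x ≤ toℕ B
    x≤B = subst (x ≤_) (sym toℕB) (ℕP.≤-pred x<a)
    B<a : toℕ B < a
    B<a = subst (_< a) (sym toℕB) (ℕP.n<1+n b)
    a≤A : a ≤ toℕ A
    a≤A = ℕP.≤-reflexive (sym toℕA)
    A<y : toℕ A < y
    A<y = subst (_< y) (sym toℕA) a<y
    raises : Raises A (+ a)
    raises = trans (m<n⇒m%n≡m a<n) (sym toℕA)
    lowers : Lowers B (+ a)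
    lowers = trans (cong (_% n) (ℕP.+-comm 1 b)) (cong (λ t → (t ℕ.+ 1) % n) (sym toℕB))
    vanishes : ∀ p q → ¬ (suc (toℕ p) ≡ a × toℕ q ≡ a) → Ω (β n x a) (β n a y) p q ≡ 0ℤ
    vanishes = Ω-β-β-vanishes x<a a<y y≤n x≢y

  ω-β-β-ordered : 2 ≤ n → ∀ {i j k} → i < k → j ≤ n → k ≤ n →
                  i % n ≢ j % n → j % n ≢ k % n → i % n ≢ k % n →
                  ω n σ (β n i j) (β n j k) ≡ ε (median i j k)
  ω-β-β-ordered 2≤n {i} {j} {k} i<k j≤n k≤n i≢j j≢k i≢k with ℕP.<-cmp i j | ℕP.<-cmp j k
  ... | tri≈ _ i≡j _ | _ = contradiction (cong (_% n) i≡j) i≢j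
  ... | _ | tri≈ _ j≡k _ = contradiction (cong (_% n) j≡k) j≢k
  ... | tri< i<j _ _ | tri< j<k _ _ = begin
    ω n σ (β n i j) (β n j k)  ≡⟨ ω-β-β-consecutive 2≤n i<j j<k k≤n i≢k ⟩
    ε j                        ≡⟨ cong ε (median-middle (ℕP.<⇒≤ i<j) (ℕP.<⇒≤ j<k)) ⟨
    ε (median i j k)           ∎
    where open ≡-Reasoning
  ... | tri< _ _ _ | tri> _ _ k<j = begin
    ω n σ (β n i j) (β n j k)
      ≡⟨ ω-linearˡ {β n i j} {β n i k} {β n k j} {β n j k} (β-split (ℕP.<⇒≤ i<k) (ℕP.<⇒≤ k<j)) ⟩
    ω n σ (β n i k) (β n j k) + ω n σ (β n k j) (β n j k)
      ≡⟨ cong₂ _+_ (ω-congʳ (β n i k) (β-comm j k)) (ω-congʳ (β n k j) (β-comm j k)) ⟩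
    ω n σ (β n i k) (β n k j) + ω n σ (β n k j) (β n k j)
      ≡⟨ cong₂ _+_ (ω-β-β-consecutive 2≤n i<k k<j j≤n i≢j) (ω-self 2≤n (β n k j)) ⟩
    ε k + 0ℤ
      ≡⟨ ℤP.+-identityʳ (ε k) ⟩
    ε k
      ≡⟨ cong ε (median-right (ℕP.<⇒≤ i<k) (ℕP.<⇒≤ k<j)) ⟨
    ε (median i j k)
      ∎
    where open ≡-Reasoning
  ... | tri> _ _ j<i | _ = begin
    ω n σ (β n i j) (β n j k)
      ≡⟨ ω-linearʳ {β n i j} {β n j k} {β n j i} {β n i k} (β-split (ℕP.<⇒≤ j<i) (ℕP.<⇒≤ i<k)) ⟩
    ω n σ (β n i j) (β n j i) + ω n σ (β n i j) (β n i k)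
      ≡⟨ cong₂ _+_ (ω-congʳ (β n i j) (β-comm j i)) (ω-congˡ (β n i k) (β-comm i j)) ⟩
    ω n σ (β n i j) (β n i j) + ω n σ (β n j i) (β n i k)
      ≡⟨ cong₂ _+_ (ω-self 2≤n (β n i j)) (ω-β-β-consecutive 2≤n j<i i<k k≤n j≢k) ⟩
    0ℤ + ε i
      ≡⟨ ℤP.+-identityˡ (ε i) ⟩
    ε i
      ≡⟨ cong ε (median-left (ℕP.<⇒≤ j<i) (ℕP.<⇒≤ i<k)) ⟨
    ε (median i j k)
      ∎
    where open ≡-Reasoning

lemma2p6 : (n : ℕ) → 3 ≤ n → .{{_ : NonZero n}} → (σ : Permutation′ n) →
           (i j k : ℕ) → i ≤ n → j ≤ n → k ≤ n →
           i % n ≢ j % n → j % n ≢ k % n → i % n ≢ k % n →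
           ω n σ (β n i j) (β n j k)
             ≡ (- (+ 1)) ^ (δ (R̄-dec n σ (+ median i j k)) ℕ.+ δ (k <? i))
lemma2p6 n 3≤n σ i j k i≤n j≤n k≤n i≢j j≢k i≢k with ℕP.<-cmp i k
... | tri≈ _ i≡k _ = contradiction (cong (_% n) i≡k) i≢k
... | tri< i<k _ _ = begin
  ω n σ (β n i j) (β n j k)  ≡⟨ ω-β-β-ordered σ (ℕP.<⇒≤ 3≤n) i<k j≤n k≤n i≢j j≢k i≢k ⟩
  ε σ (median i j k)         ≡⟨ cong ((- 1ℤ) ^_) (ℕP.+-identityʳ R) ⟨
  (- 1ℤ) ^ (R ℕ.+ 0)         ≡⟨ cong (λ t → (- 1ℤ) ^ (R ℕ.+ t)) (δ-no (k <? i) (ℕP.<⇒≯ i<k)) ⟨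
  (- 1ℤ) ^ (R ℕ.+ δ (k <? i)) ∎
  where
  open ≡-Reasoning
  R = δ (R̄-dec n σ (+ median i j k))
... | tri> _ _ k<i = begin
  ω n σ (β n i j) (β n j k)    ≡⟨ ω-cong σ (β-comm i j) (β-comm j k) ⟩
  ω n σ (β n j i) (β n k j)    ≡⟨ ω-antisym σ 2≤n (β n k j) (β n j i) ⟩
  - ω n σ (β n k j) (β n j i)  ≡⟨ cong -_ (ω-β-β-ordered σ 2≤n k<i j≤n i≤n (j≢k ∘ sym) (i≢j ∘ sym) (i≢k ∘ sym)) ⟩
  - ε σ (median k j i)         ≡⟨ cong (-_ ∘ ε σ) (median-comm i j k) ⟨
  - ε σ (median i j k)         ≡⟨ -1^[m+1]≡-[-1^m] R ⟨
  (- 1ℤ) ^ (R ℕ.+ 1)           ≡⟨ cong (λ t → (- 1ℤ) ^ (R ℕ.+ t)) (δ-yes (k <? i) k<i) ⟨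
  (- 1ℤ) ^ (R ℕ.+ δ (k <? i))  ∎
  where
  open ≡-Reasoning
  2≤n = ℕP.<⇒≤ 3≤n
  R = δ (R̄-dec n σ (+ median i j k))
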